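{- Let $F\in NDF'$. For sets $X,Y$ define $\mathrm{sync}^F_{X,Y}:F(X)\times F(Y)\to F(X\times Y)$ by structural induction on $F$: for $x\in F(X)$, $y\in F(Y)$, $x\,\mathrm{sync}^{\mathbf{Id}}_{X,Y}\,y=(x,y)$; $x\,\mathrm{sync}^{\mathbf{B}}_{X,Y}\,y=x\vee y$; $(x_1,x_2)\,\mathrm{sync}^{F_1\times F_2}_{X,Y}\,(y_1,y_2)=\big(x_1\,\mathrm{sync}^{F_1}_{X,Y}\,y_1,\ x_2\,\mathrm{sync}^{F_2}_{X,Y}\,y_2\big)$; $x\,\mathrm{sync}^{G^{\mathbf{A}}}_{X,Y}\,y=\lambda a.\big(x(a)\,\mathrm{sync}^{G}_{X,Y}\,y(a)\big)$; $x\,\mathrm{sync}^{\mathcal{P}_\omega(G)}_{X,Y}\,y=\{x'\,\mathrm{sync}^{G}_{X,Y}\,y'\mid x'\in x,\ y'\in y\}$. Then $\mathrm{sync}^F$ is a natural transformation from $(X,Y)\mapsto F(X)\times F(Y)$ to $(X,Y)\mapsto F(X\times Y)$: for all maps $h_1:X\to X'$, $h_2:Y\to Y'$ and all $x\in F(X)$, $y\in F(Y)$, $$F(h_1\times h_2)\big(x\,\mathrm{sync}^F_{X,Y}\,y\big)=F(h_1)(x)\,\mathrm{sync}^F_{X',Y'}\,F(h_2)(y).$$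
   Context: $\mathbf{A}$ is a fixed set of actions. $NDF'$ is the class of functors on $\mathbf{Set}$ generated by the grammar $F::=\mathbf{Id}\mid \mathbf{B}\mid F\times F\mid F^{\mathbf{A}}\mid \mathcal{P}_\omega(F)$, where $\mathbf{Id}$ is the identity functor, $\mathbf{B}\neq\emptyset$ is a constant functor given by a join-semilattice with bottom (join $\vee$), acting on maps as $id_{\mathbf{B}}$; $(F_1\times F_2)(X)=F_1(X)\times F_2(X)$ and $(F_1\times F_2)(f)=F_1(f)\times F_2(f)$; $G^{\mathbf{A}}(X)=G(X)^{\mathbf{A}}$ with $G^{\mathbf{A}}(f)(g)=G(f)\circ g$; $\mathcal{P}_\omega(G)(X)$ is the set of finite subsets of $G(X)$ with $\mathcal{P}_\omega(G)(f)(S)=\{G(f)(x)\mid x\in S\}$. For maps $h_1,h_2$, $h_1\times h_2:(x,y)\mapsto(h_1(x),h_2(y))$. -}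

module Defs where

open import Level using (0ℓ)
open import Data.Product using (_×_; _,_)
open import Data.List using (List; map; concatMap)
open import Data.List.Relation.Unary.All using (All)
open import Data.List.Relation.Unary.Any using (Any)
open import Relation.Binary.PropositionalEquality using (_≡_)
open import Relation.Binary.Lattice using (BoundedJoinSemilattice)
open BoundedJoinSemilattice using (Carrier; _∨_)

-- Codes for the functors of NDF' over a fixed set of actions A.
data Code (A : Set) : Set₁ where
  Id  : Code A
  K   : BoundedJoinSemilattice 0ℓ 0ℓ 0ℓ → Code A
  _⊗_ : Code A → Code A → Code A
  Exp : Code A → Code A
  Pω  : Code A → Code A

-- Object part. Finite subsets are represented by lists (up to ≈F below).
⟦_⟧ : ∀ {A} → Code A → Set → Set
⟦_⟧         Id      X = X
⟦_⟧         (K B)   X = Carrier B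
⟦_⟧         (F ⊗ G) X = ⟦ F ⟧ X × ⟦ G ⟧ X
⟦_⟧ {A}     (Exp G) X = A → ⟦ G ⟧ X
⟦_⟧         (Pω G)  X = List (⟦ G ⟧ X)

fmap : ∀ {A} (F : Code A) {X Y : Set} → (X → Y) → ⟦ F ⟧ X → ⟦ F ⟧ Y
fmap Id      f x        = f x
fmap (K B)   f b        = b
fmap (F ⊗ G) f (x , y)  = fmap F f x , fmap G f y
fmap (Exp G) f g        = λ a → fmap G f (g a)
fmap (Pω G)  f s        = map (fmap G f) s

EqF : ∀ {A} (F : Code A) {X : Set} → ⟦ F ⟧ X → ⟦ F ⟧ X → Set
EqF Id      x y               = x ≡ y
EqF (K B)   x y               = x ≡ y
EqF (F ⊗ G) (x₁ , x₂) (y₁ , y₂) = EqF F x₁ y₁ × EqF G x₂ y₂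
EqF (Exp G) x y               = ∀ a → EqF G (x a) (y a)
EqF (Pω G)  s t               =
  All (λ u → Any (λ v → EqF G u v) t) s × All (λ v → Any (λ u → EqF G u v) s) t

_⊠_ : {X X' Y Y' : Set} → (X → X') → (Y → Y') → X × Y → X' × Y'
(h₁ ⊠ h₂) (x , y) = h₁ x , h₂ y

sync : ∀ {A} (F : Code A) {X Y : Set} → ⟦ F ⟧ X → ⟦ F ⟧ Y → ⟦ F ⟧ (X × Y)
sync Id      x y                 = x , y
sync (K B)   x y                 = _∨_ B x y
sync (F ⊗ G) (x₁ , x₂) (y₁ , y₂) = sync F x₁ y₁ , sync G x₂ y₂
sync (Exp G) x y                 = λ a → sync G (x a) (y a)
sync (Pω G)  s t                 = concatMap (λ x' → map (λ y' → sync G x' y') t) s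

module Submission where

-- The only real work is the finite-powerset case: there
-- sync^{Pω G} s t is the list of all pairings  x' sync^G y'  (x' ∈ s,
-- y' ∈ t), and F(h₁ × h₂) acts on it elementwise.

open import Defs
open import Data.Product using (_,_)
open import Data.List using (List; []; _∷_; map; concatMap)
open import Data.List.Properties using (map-++)
open import Data.List.Relation.Unary.All as All using (All; []; _∷_)
open import Data.List.Relation.Unary.Any using (Any; here; there)
open import Data.List.Relation.Binary.Pointwise as Pointwise using (Pointwise; []; _∷_; ++⁺; map⁺)
open import Relation.Binary.PropositionalEquality using (refl)

pairWith : {T U V : Set} → (T → U → V) → List T → List U → List V
pairWith f s t = concatMap (λ x → map (f x) t) s

pairWith-natural : {T U V T' U' V' : Set} (R : V' → V' → Set)
  (f : T → U → V) (g : T' → U' → V')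
  (h : V → V') (h₁ : T → T') (h₂ : U → U') →
  (∀ x y → R (h (f x y)) (g (h₁ x) (h₂ y))) →
  ∀ s t → Pointwise R (map h (pairWith f s t)) (pairWith g (map h₁ s) (map h₂ t))
pairWith-natural R f g h h₁ h₂ natural [] t = []
pairWith-natural R f g h h₁ h₂ natural (x ∷ s) t
  rewrite map-++ h (map (f x) t) (pairWith f s t)
  = ++⁺ row (pairWith-natural R f g h h₁ h₂ natural s t)
  where
  row : Pointwise R (map h (map (f x) t)) (map (g (h₁ x)) (map h₂ t))
  row = map⁺ h (g (h₁ x)) (map⁺ (f x) h₂ (Pointwise.refl (λ {y} → natural x y)))

pointwise⇒covered : {T U : Set} {R : T → U → Set} {xs : List T} {ys : List U} →
  Pointwise R xs ys → All (λ x → Any (R x) ys) xs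
pointwise⇒covered []       = []
pointwise⇒covered (r ∷ rs) = here r ∷ All.map there (pointwise⇒covered rs)

pointwise⇒sameSet : ∀ {A} (G : Code A) {X : Set} {s t : List (⟦ G ⟧ X)} →
  Pointwise (EqF G) s t → EqF (Pω G) s t
pointwise⇒sameSet G rs =
  pointwise⇒covered rs , pointwise⇒covered (Pointwise.symmetric (λ r → r) rs)

mainTheorem6 : (A : Set) (F : Code A) {X X' Y Y' : Set}
               (h₁ : X → X') (h₂ : Y → Y') (x : ⟦ F ⟧ X) (y : ⟦ F ⟧ Y) →
               EqF F (fmap F (h₁ ⊠ h₂) (sync F x y)) (sync F (fmap F h₁ x) (fmap F h₂ y))
mainTheorem6 A Id      h₁ h₂ x y = refl
mainTheorem6 A (K B)   h₁ h₂ b c = refl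
mainTheorem6 A (F ⊗ G) h₁ h₂ (x₁ , x₂) (y₁ , y₂) =
  mainTheorem6 A F h₁ h₂ x₁ y₁ , mainTheorem6 A G h₁ h₂ x₂ y₂
mainTheorem6 A (Exp G) h₁ h₂ x y = λ a → mainTheorem6 A G h₁ h₂ (x a) (y a)
mainTheorem6 A (Pω G)  h₁ h₂ s t =
  pointwise⇒sameSet G
    (pairWith-natural (EqF G) (sync G) (sync G) (fmap G (h₁ ⊠ h₂)) (fmap G h₁) (fmap G h₂)
                      (mainTheorem6 A G h₁ h₂) s t)
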